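{- Let $j, a, b$ be positive integers with $1 \leq a < b$. Then $$j\,([0,a] \cup \{b\}) = [0, jb] \setminus \bigcup_{i=1}^{\lfloor (b-2)/a \rfloor} [\, jb - ib + ia + 1,\; jb - ib + b - 1\,].$$
   Context: For integers $x \le y$, $[x,y] = \{x, x+1, \ldots, y\}$ (empty if $x>y$). For a finite set $A$ of integers and a positive integer $k$, $kA = \{\sum_{i=1}^{k} a_i : a_i \in A\}$ (the $k$-fold sumset). -}

module Defs where

open import Data.Nat using (ℕ)
open import Data.Integer using (ℤ; +_; _+_; _-_; _*_; _≤_)
open import Data.Vec using (Vec)
open import Data.Vec.Relation.Unary.All using (All)
open import Data.Product using (Σ; ∃; _×_)
open import Data.Sum using (_⊎_)
open import Relation.Binary.PropositionalEquality using (_≡_)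
open import Relation.Nullary using (¬_)
open import Level using (0ℓ)
open import Relation.Unary using (Pred)

ISet : Set₁
ISet = Pred ℤ 0ℓ

Interval : ℤ → ℤ → ISet
Interval x y n = x ≤ n × n ≤ y

sumℤ : ∀ {k} → Vec ℤ k → ℤ
sumℤ Data.Vec.[] = + 0
sumℤ (x Data.Vec.∷ xs) = x + sumℤ xs

Sumset : ℕ → ISet → ISet
Sumset k A n = Σ (Vec ℤ k) λ v → All A v × sumℤ v ≡ n

Base : ℕ → ℕ → ISet
Base a b n = Interval (+ 0) (+ a) n ⊎ n ≡ + b

RHS : ℕ → ℕ → ℕ → ℕ → ISet
RHS j a b m n =
  Interval (+ 0) (+ j * + b) n ×
  ¬ (Σ ℕ λ i → (1 Data.Nat.≤ i × i Data.Nat.≤ m) ×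
       Interval (+ j * + b - + i * + b + + i * + a + + 1)
                (+ j * + b - + i * + b + + b - + 1) n)

-- A sum of j elements of [0,a] ∪ {b} with k summands equal to b is k·b + t with
-- 0 ≤ t ≤ (j − k)·a, and every such number occurs.  Inside [k·b, (k + 1)·b) these sums reach
-- exactly up to k·b + (j − k)·a: sums with fewer copies of b end no higher because a ≤ b, and
-- sums with more copies of b start at (k + 1)·b or later.  So the numbers of [0, jb] that are
-- missed form the gaps [k·b + i·a + 1, k·b + b − 1] with i = j − k ≥ 1, nonempty exactly when
-- i·a ≤ b − 2, i.e. i ≤ ⌊(b − 2)/a⌋.
module Submission where

open import Defs
open import Data.Nat using (ℕ; _≤_; _<_; _/_; _∸_; NonZero)
open import Data.Integer using (ℤ)
open import Function.Bundles using (_⇔_)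

open import Data.Nat using (zero; suc; z≤n; s≤s; _+_; _*_; _%_; _≤?_; >-nonZero)
open import Data.Nat.Properties
open import Data.Nat.DivMod
import Data.Nat.Tactic.RingSolver as ℕ-Solver
import Data.Integer as ℤ
open import Data.Integer using (+_; -[1+_]; +≤+; 1ℤ; -1ℤ)
import Data.Integer.Properties as ℤP
import Data.Integer.Tactic.RingSolver as ℤ-Solver
open import Data.Vec using ([]; _∷_)
open import Data.Vec.Relation.Unary.All as All using ([]; _∷_)
open import Data.Product using (Σ-syntax; _×_; _,_)
open import Data.Sum using (inj₁; inj₂)
open import Data.Empty using (⊥; ⊥-elim)
open import Relation.Nullary using (¬_; yes; no)
open import Relation.Unary using (_⊆_)
open import Relation.Binary.PropositionalEquality
open import Function.Bundles using (mk⇔)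
open import Function.Base using (_∘_; case_of_)

open ≤-Reasoning

private
  variable
    a b d i i′ j k k′ n t : ℕ

_∷ˢ_ : ∀ {A : ISet} {x s} → A x → Sumset k A s → Sumset (suc k) A (x ℤ.+ s)
px ∷ˢ (v , pv , refl) = _ ∷ v , px ∷ pv , refl

Sumset-mono : ∀ {A B : ISet} → A ⊆ B → Sumset k A ⊆ Sumset k B
Sumset-mono A⊆B (v , pv , e) = v , All.map A⊆B pv , e

interval-sumset : ∀ i t → t ≤ i * a → Sumset i (Interval (+ 0) (+ a)) (+ t)
interval-sumset zero zero _ = [] , [] , refl
interval-sumset {a} (suc i) t t≤ with a ≤? t
... | yes a≤t = subst (Sumset _ _) (cong +_ (m+[n∸m]≡n a≤t))
                  ((+≤+ z≤n , +≤+ ≤-refl) ∷ˢ interval-sumset i (t ∸ a) (m≤n+o⇒m∸n≤o t a t≤))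
... | no a≰t  = subst (Sumset _ _) (cong +_ (+-identityʳ t))
                  ((+≤+ z≤n , +≤+ (≰⇒≥ a≰t)) ∷ˢ interval-sumset i 0 z≤n)

add-copies : ∀ {A : ISet} k → A (+ b) → Sumset i A (+ t) → Sumset (k + i) A (+ (k * b + t))
add-copies zero _ s = s
add-copies {b} {t = t} {A} (suc k) pb s =
  subst (Sumset _ A) (cong +_ (sym (+-assoc b (k * b) t))) (pb ∷ˢ add-copies k pb s)

Decomposition : ℕ → ℕ → ℕ → ℤ → Set
Decomposition j a b n = Σ[ i ∈ ℕ ] Σ[ k ∈ ℕ ] Σ[ t ∈ ℕ ] i + k ≡ j × t ≤ i * a × n ≡ + (k * b + t)

sumset⇒decomposition : ∀ j {n} → Sumset j (Base a b) n → Decomposition j a b n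
sumset⇒decomposition zero ([] , [] , refl) = 0 , 0 , 0 , refl , z≤n , refl
sumset⇒decomposition {a} {b} (suc j) (x ∷ v , px ∷ pv , refl)
  with sumset⇒decomposition j (v , pv , refl) | px
... | i , k , t , refl , t≤ia , eq | inj₂ refl =
  i , suc k , t , +-suc i k , t≤ia ,
  trans (cong (ℤ._+_ (+ b)) eq) (cong +_ (sym (+-assoc b (k * b) t)))
... | i , k , t , refl , t≤ia , eq | inj₁ (+≤+ {n = x′} z≤n , +≤+ x′≤a) =
  suc i , k , x′ + t , refl , +-mono-≤ x′≤a t≤ia ,
  trans (cong (ℤ._+_ (+ x′)) eq) (cong +_ (left-comm x′ (k * b) t))
  where
  left-comm : ∀ x y z → x + (y + z) ≡ y + (x + z)
  left-comm = ℕ-Solver.solve-∀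

decomposition⇒sumset : ∀ {n} → Decomposition j a b n → Sumset j (Base a b) n
decomposition⇒sumset {a = a} {b} (i , k , t , refl , t≤ia , refl) =
  subst (λ m → Sumset m (Base a b) (+ (k * b + t))) (+-comm k i)
    (add-copies k (inj₂ refl) (Sumset-mono inj₁ (interval-sumset i t t≤ia)))

gapStart gapEnd : ℕ → ℕ → ℕ → ℕ → ℤ
gapStart j a b i = + j ℤ.* + b ℤ.- + i ℤ.* + b ℤ.+ + i ℤ.* + a ℤ.+ + 1
gapEnd   j a b i = + j ℤ.* + b ℤ.- + i ℤ.* + b ℤ.+ + b ℤ.- + 1

gapStart-+ : ∀ i k a b → gapStart (i + k) a b i ≡ + suc (k * b + i * a)
gapStart-+ i k a b = trans (normalise (+ i) (+ k) (+ a) (+ b))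
  (cong₂ (λ x y → 1ℤ ℤ.+ (x ℤ.+ y)) (sym (ℤP.pos-* k b)) (sym (ℤP.pos-* i a)))
  where
  normalise : ∀ I K A B →
    (I ℤ.+ K) ℤ.* B ℤ.- I ℤ.* B ℤ.+ I ℤ.* A ℤ.+ 1ℤ ≡ 1ℤ ℤ.+ (K ℤ.* B ℤ.+ I ℤ.* A)
  normalise = ℤ-Solver.solve-∀

gapEnd-+ : ∀ i k a b → gapEnd (i + k) a b i ≡ ℤ.pred (+ (k * b + b))
gapEnd-+ i k a b = trans (normalise (+ i) (+ k) (+ b))
  (cong (λ x → -1ℤ ℤ.+ (x ℤ.+ + b)) (sym (ℤP.pos-* k b)))
  where
  normalise : ∀ I K B → (I ℤ.+ K) ℤ.* B ℤ.- I ℤ.* B ℤ.+ B ℤ.- 1ℤ ≡ -1ℤ ℤ.+ (K ℤ.* B ℤ.+ B)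
  normalise = ℤ-Solver.solve-∀

gapEnd-beyond : ∀ j d a b → gapEnd j a b (suc (j + d)) ≡ -[1+ d * b ]
gapEnd-beyond j d a b = trans (normalise (+ j) (+ d) (+ b))
  (trans (cong (λ x → -1ℤ ℤ.+ ℤ.- x) (sym (ℤP.pos-* d b))) (sym (ℤP.neg-suc (d * b))))
  where
  normalise : ∀ J D B → J ℤ.* B ℤ.- (1ℤ ℤ.+ (J ℤ.+ D)) ℤ.* B ℤ.+ B ℤ.- 1ℤ ≡ -1ℤ ℤ.+ ℤ.- (D ℤ.* B)
  normalise = ℤ-Solver.solve-∀

∈gap⇒ : Interval (gapStart j a b i) (gapEnd j a b i) (+ n) →
        Σ[ k ∈ ℕ ] i + k ≡ j × k * b + i * a < n × n < k * b + b
∈gap⇒ {j} {a} {b} {i} (lo , hi) with i ≤? j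
... | yes i≤j with m≤n⇒∃[o]m+o≡n i≤j
...   | k , refl = k , refl ,
        ℤP.drop‿+≤+ (subst (ℤ._≤ _) (gapStart-+ i k a b) lo) ,
        ℤP.drop‿+<+ (ℤP.i≤pred[j]⇒i<j (subst (_ ℤ.≤_) (gapEnd-+ i k a b) hi))
∈gap⇒ {j} {a} {b} {i} (lo , hi) | no i≰j with m≤n⇒∃[o]m+o≡n (≰⇒> i≰j)
... | d , refl with () ← subst (_ ℤ.≤_) (gapEnd-beyond j d a b) hi

∈gap⇐ : k * b + i * a < n → n < k * b + b →
        Interval (gapStart (i + k) a b i) (gapEnd (i + k) a b i) (+ n)
∈gap⇐ {k} {b} {i} {a} lo hi =
  subst (ℤ._≤ _) (sym (gapStart-+ i k a b)) (+≤+ lo) ,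
  subst (_ ℤ.≤_) (sym (gapEnd-+ i k a b)) (ℤP.i<j⇒i≤pred[j] (ℤ.+<+ hi))

block-below-gap : a ≤ b → t ≤ (i + d) * a → k * b + t ≤ (k + d) * b + i * a
block-below-gap {a} {b} {t} {i} {d} {k} a≤b t≤ = begin
  k * b + t               ≤⟨ +-monoʳ-≤ (k * b) t≤ ⟩
  k * b + (i + d) * a     ≡⟨ expand k b i d a ⟩
  k * b + d * a + i * a   ≤⟨ +-monoˡ-≤ (i * a) (+-monoʳ-≤ (k * b) (*-monoʳ-≤ d a≤b)) ⟩
  k * b + d * b + i * a   ≡⟨ cong (_+ i * a) (sym (*-distribʳ-+ b k d)) ⟩
  (k + d) * b + i * a     ∎
  where
  expand : ∀ k b i d a → k * b + (i + d) * a ≡ k * b + d * a + i * a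
  expand = ℕ-Solver.solve-∀

decomposition-avoids-gap : a ≤ b → t ≤ i * a → i + k ≡ i′ + k′ →
                           k′ * b + i′ * a < k * b + t → k * b + t < k′ * b + b → ⊥
decomposition-avoids-gap {a} {b} {t} {i} {k} {i′} {k′} a≤b t≤ia i+k≡i′+k′ lo hi with k ≤? k′
... | no k≰k′ = <⇒≱ hi (begin
  k′ * b + b     ≡⟨ +-comm (k′ * b) b ⟩
  suc k′ * b     ≤⟨ *-monoˡ-≤ b (≰⇒> k≰k′) ⟩
  k * b          ≤⟨ m≤m+n (k * b) t ⟩
  k * b + t      ∎)
... | yes k≤k′ with m≤n⇒∃[o]m+o≡n k≤k′
...   | d , refl =
  <⇒≱ lo (block-below-gap {i = i′} {d = d} {k = k} a≤b (subst (λ x → t ≤ x * a) i≡i′+d t≤ia))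
  where
  shuffle : ∀ i′ k d → i′ + (k + d) ≡ i′ + d + k
  shuffle = ℕ-Solver.solve-∀
  i≡i′+d : i ≡ i′ + d
  i≡i′+d = +-cancelʳ-≡ k i (i′ + d) (trans i+k≡i′+k′ (shuffle i′ k d))

m*n≤o⇒m≤o/n : ∀ m {n o} .{{_ : NonZero n}} → m * n ≤ o → m ≤ o / n
m*n≤o⇒m≤o/n m {n} m*n≤o = subst (_≤ _) (m*n/n≡m m n) (/-monoˡ-≤ n m*n≤o)

decomposition⇒rhs : ∀ {n} m → a ≤ b → Decomposition j a b n → RHS j a b m n
decomposition⇒rhs {a} {b} m a≤b (i , k , t , refl , t≤ia , refl) =
  (+≤+ z≤n , subst (_ ℤ.≤_) (ℤP.pos-* (i + k) b) (+≤+ ≤-block)) , outside-gaps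
  where
  ≤-block : k * b + t ≤ (i + k) * b
  ≤-block = begin
    k * b + t        ≤⟨ +-monoʳ-≤ (k * b) (≤-trans t≤ia (*-monoʳ-≤ i a≤b)) ⟩
    k * b + i * b    ≡⟨ +-comm (k * b) (i * b) ⟩
    i * b + k * b    ≡⟨ *-distribʳ-+ b i k ⟨
    (i + k) * b      ∎
  outside-gaps : ¬ (Σ[ i′ ∈ ℕ ] (1 ≤ i′ × i′ ≤ m) ×
                    Interval (gapStart (i + k) a b i′) (gapEnd (i + k) a b i′) (+ (k * b + t)))
  outside-gaps (i′ , _ , in-gap) with ∈gap⇒ {j = i + k} {a = a} {b = b} {i = i′} in-gap
  ... | k′ , i′+k′≡i+k , lo , hi =
    decomposition-avoids-gap {i = i} {k = k} {i′ = i′} {k′ = k′} a≤b t≤ia (sym i′+k′≡i+k) lo hi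

rhs⇒decomposition : ∀ j a b {n} .{{_ : NonZero a}} .{{_ : NonZero b}} →
                    RHS j a b ((b ∸ 2) / a) n → Decomposition j a b n
rhs⇒decomposition j a b ((+≤+ {n = n} z≤n , n≤jb) , outside-gaps) = case r ≤? i₀ * a of λ where
    (yes r≤ia) → i₀ , q , r , i+q≡j , r≤ia , cong +_ n≡qb+r
    (no r≰ia)  → ⊥-elim (outside-gaps (i₀ , (0<i₀ (≰⇒> r≰ia) , i≤m (≰⇒> r≰ia)) ,
                   subst (λ J → Interval (gapStart J a b i₀) (gapEnd J a b i₀) (+ n)) i+q≡j
                     (∈gap⇐ {k = q} {b = b} {i = i₀} {a = a} (lo (≰⇒> r≰ia)) hi)))
  where
  q r i₀ : ℕ
  q = n / b
  r = n % b
  i₀ = j ∸ q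
  n≡qb+r : n ≡ q * b + r
  n≡qb+r = trans (m≡m%n+[m/n]*n n b) (+-comm r (q * b))
  n≤j*b : n ≤ j * b
  n≤j*b = ℤP.drop‿+≤+ (subst (_ ℤ.≤_) (sym (ℤP.pos-* j b)) n≤jb)
  i+q≡j : i₀ + q ≡ j
  i+q≡j = m∸n+n≡m (*-cancelʳ-≤ q j b (≤-trans (m/n*n≤m n b) n≤j*b))
  r<b : r < b
  r<b = m%n<n n b
  lo : i₀ * a < r → q * b + i₀ * a < n
  lo ia<r = subst (q * b + i₀ * a <_) (sym n≡qb+r) (+-monoʳ-< (q * b) ia<r)
  hi : n < q * b + b
  hi = subst (_< q * b + b) (sym n≡qb+r) (+-monoʳ-< (q * b) r<b)
  0<i₀ : i₀ * a < r → 1 ≤ i₀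
  0<i₀ ia<r = m<n⇒0<n∸m (*-cancelʳ-< b q j (begin-strict
    q * b        <⟨ m<m+n (q * b) (≤-<-trans z≤n ia<r) ⟩
    q * b + r    ≡⟨ n≡qb+r ⟨
    n            ≤⟨ n≤j*b ⟩
    j * b        ∎))
  i≤m : i₀ * a < r → i₀ ≤ (b ∸ 2) / a
  i≤m ia<r = m*n≤o⇒m≤o/n i₀
    (m+n≤o⇒m≤o∸n (i₀ * a) (subst (_≤ b) (+-comm 2 (i₀ * a)) (≤-trans (s≤s ia<r) r<b)))

lemma5 : (j a b : ℕ) → 1 ≤ j → .{{_ : NonZero a}} → a < b →
    (n : ℤ) → Sumset j (Base a b) n ⇔ RHS j a b ((b ∸ 2) / a) n
lemma5 j a b _ a<b n = mk⇔
  (decomposition⇒rhs _ (<⇒≤ a<b) ∘ sumset⇒decomposition j)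
  (decomposition⇒sumset ∘ rhs⇒decomposition j a b)
  where
  instance
    b≢0 : NonZero b
    b≢0 = >-nonZero (≤-<-trans z≤n a<b)
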